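{- Let $t,\eta\ge 1$ and $\zeta\ge 2$ be integers. Let $G$ be a graph and let $(T,r)$ be a $(t\zeta,\eta)$-uniform rooted tree, where $T$ is a subgraph of $G$; and let $u\in V(G)\setminus V(T)$. If $u$ is not $t$-bad for $(T,r)$, then there is a $(\zeta,\eta)$-uniform rooted subtree $(S,r)$ of $(T,r)$ such that $u$ has no $G$-neighbour in $V(S)$ except possibly $r$.
   Context: All graphs are finite, without loops or parallel edges; a subgraph need not be induced. A rooted tree $(H,r)$ is a tree $H$ with a distinguished vertex $r$ (the root). A rooted subtree of $(H,r)$ is a rooted tree $(J,r)$ where $J$ is a subtree of $H$ with $r\in V(J)$. If $u,v\in V(H)$ are adjacent and $u$ lies on the path of $H$ between $v$ and $r$, then $v$ is a child of $u$. For integers $z,\eta\ge 1$, $(H,r)$ is $(z,\eta)$-uniform if every vertex with a child has exactly $z$ children, and every vertex with no child is joined to $r$ by a path of $H$ of length exactly $\eta$. If $(T,r)$ is a $(z,\eta)$-uniform rooted tree with $T$ a subgraph of $G$, a vertex $u\in V(G)\setminus V(T)$ is $t$-bad for $(T,r)$ if there is a vertex $w\in V(T)$ having $z$ children in $(T,r)$ such that $u$ is adjacent in $G$ to more than $(t-1)z/t$ of these children. (Here $z=t\zeta$.) -}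

module Defs where

open import Data.Nat using (ℕ; suc; _*_; _∸_; _<_; _≤_)
open import Data.Bool using (Bool; true; false)
open import Data.Fin using (Fin)
open import Data.List using (List; []; _∷_; length; head; last)
open import Data.List.Relation.Unary.All using (All)
open import Data.List.Relation.Unary.Unique.Propositional using (Unique)
open import Data.List.Membership.Propositional using (_∈_)
open import Data.Maybe using (just)
open import Data.Unit using (⊤)
open import Data.Product using (Σ; ∃; _×_)
open import Function.Bundles using (_⇔_)
open import Relation.Nullary using (¬_)
open import Relation.Binary.PropositionalEquality using (_≡_)

-- A finite simple graph whose vertex set is a subset of Fin n.
-- (Bool-valued vertex / edge indicators: no parallel edges, no loops.)
record Graph (n : ℕ) : Set where
  field
    V      : Fin n → Bool
    E      : Fin n → Fin n → Bool
    E-sym  : ∀ x y → E x y ≡ E y x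
    E-irr  : ∀ x → E x x ≡ false
    E-V    : ∀ x y → E x y ≡ true → V x ≡ true
open Graph public

_⊆G_ : ∀ {n} → Graph n → Graph n → Set
H ⊆G G = (∀ x → V H x ≡ true → V G x ≡ true)
       × (∀ x y → E H x y ≡ true → E G x y ≡ true)

Chain : ∀ {n} → Graph n → List (Fin n) → Set
Chain H []            = ⊤
Chain H (x ∷ [])      = ⊤
Chain H (x ∷ y ∷ xs)  = (E H x y ≡ true) × Chain H (y ∷ xs)

IsPath : ∀ {n} → Graph n → List (Fin n) → Set
IsPath H p = Unique p × All (λ v → V H v ≡ true) p × Chain H p

PathOfLength : ∀ {n} → Graph n → Fin n → Fin n → ℕ → List (Fin n) → Set
PathOfLength H a b ℓ p =
  IsPath H p × head p ≡ just a × last p ≡ just b × length p ≡ suc ℓ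

Connected : ∀ {n} → Graph n → Set
Connected H = ∀ a b → V H a ≡ true → V H b ≡ true →
  ∃ λ ℓ → ∃ λ p → PathOfLength H a b ℓ p

IsCycle : ∀ {n : ℕ} → Graph n → List (Fin n) → Set
IsCycle {n} H p = IsPath H p × 3 ≤ length p ×
  Σ (Fin n) λ a → Σ (Fin n) λ b → head p ≡ just a × last p ≡ just b × E H b a ≡ true

Acyclic : ∀ {n} → Graph n → Set
Acyclic H = ∀ p → ¬ IsCycle H p

IsTree : ∀ {n} → Graph n → Set
IsTree H = Connected H × Acyclic H

RootedTree : ∀ {n} → Graph n → Fin n → Set
RootedTree H r = IsTree H × V H r ≡ true

Child : ∀ {n} → Graph n → Fin n → Fin n → Fin n → Set
Child H r u v = E H u v ≡ true ×
  ∃ λ ℓ → ∃ λ p → PathOfLength H v r ℓ p × u ∈ p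

HasChildren : ∀ {n} → Graph n → Fin n → Fin n → ℕ → Set
HasChildren H r u z = ∃ λ cs → Unique cs × length cs ≡ z ×
  (∀ v → (v ∈ cs) ⇔ Child H r u v)

Uniform : ∀ {n} → ℕ → ℕ → Graph n → Fin n → Set
Uniform z η H r = RootedTree H r
  × (∀ u → (∃ λ v → Child H r u v) → HasChildren H r u z)
  × (∀ u → V H u ≡ true → (∀ v → ¬ Child H r u v) →
       ∃ λ p → PathOfLength H u r η p)

-- u ∉ V(T) is t-bad for (T , r) (with z = the branching number of T):
-- some w ∈ V(T) has z children and u is G-adjacent to more than (t-1)z/t of them,
-- i.e. to m of them with t·m > (t-1)·z.
Bad : ∀ {n} → Graph n → Graph n → Fin n → ℕ → ℕ → Fin n → Set
Bad {n} G T r z t u = V T u ≡ false × Σ (Fin n) λ w → V T w ≡ true × HasChildren T r w z ×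
  ∃ λ ls → Unique ls × All (λ c → Child T r w c × E G u c ≡ true) ls
         × (t ∸ 1) * z < t * length ls

{-# OPTIONS --safe #-}
-- As u is not t-bad, a vertex of T with children has at most (t-1)ζ of its tζ children adjacent
-- to u, hence at least ζ that are not; choose ζ of those.  Let S be spanned by the vertices whose
-- path to r in T consists of r and chosen vertices.  Since paths in a tree are unique, the
-- children of a vertex w in S are exactly the chosen children of w; so a leaf of S has no
-- chosen children, hence is a leaf of T, at distance η from r.  Every vertex of S other than r
-- is chosen, hence not adjacent to u.
module Submission where

open import Defs
open import Data.Bool using (true; false; _∧_)
open import Data.Bool.Properties using (∧-comm; ∧-conicalˡ; ∧-conicalʳ) renaming (_≟_ to _≟ᵇ_)
open import Data.Empty using (⊥-elim)
open import Data.Fin using (Fin; _≟_)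
open import Data.Fin.Properties using (any?)
open import Data.List using (List; []; _∷_; _++_; [_]; _ʳ++_; length; last; drop; filter; take)
open import Data.List.Properties using (++-assoc; ∷-injectiveˡ; ++-ʳ++; length-ʳ++; length-take)
open import Data.List.Membership.Propositional using (_∈_; _∉_)
open import Data.List.Membership.Propositional.Properties using (∈-∃++; ∈-++⁺ˡ; ∈-++⁺ʳ; ∈-++⁻)
open import Data.List.Relation.Unary.All as All using (All; []; _∷_)
import Data.List.Relation.Unary.All.Properties as All
open import Data.List.Relation.Unary.Any using (here; there)
open import Data.List.Relation.Unary.AllPairs using ([]; _∷_)
open import Data.List.Relation.Unary.Unique.Propositional using (Unique)
import Data.List.Relation.Unary.Unique.Propositional.Properties as Unique
open import Data.Maybe using (just)
open import Data.Maybe.Properties using (just-injective)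
open import Data.Nat using (ℕ; suc; _+_; _*_; _∸_; _≤_; _<_; _≤?_; s≤s; z≤n)
open import Data.Nat.Properties
  using (*-commutativeSemigroup; +-comm; +-suc; +-monoʳ-<; +-cancelʳ-<; *-monoʳ-<; ≤-trans; m≤n+m; m≤n⇒m⊓n≡m; ≰⇒>)
open import Algebra.Properties.CommutativeSemigroup *-commutativeSemigroup using (x∙yz≈y∙xz)
open import Data.Product using (Σ; ∃; ∃₂; _×_; _,_; proj₁; proj₂)
open import Data.Sum using (_⊎_; inj₁; inj₂)
open import Data.Unit using (tt)
open import Function using (_∘_)
open import Function.Bundles using (_⇔_; mk⇔; Equivalence)
open import Relation.Binary.Definitions using (DecidableEquality)
open import Relation.Binary.PropositionalEquality using (_≡_; _≢_; refl; sym; trans; cong; cong₂; subst)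
open import Relation.Nullary using (¬_; Dec; yes; no; does; ¬?; _×-dec_; _⊎-dec_)
import Relation.Nullary.Decidable as Dec
open import Relation.Unary using (Decidable)

∧-true⇒ : ∀ {a b} → a ∧ b ≡ true → a ≡ true × b ≡ true
∧-true⇒ {a} {b} e = ∧-conicalˡ a b e , ∧-conicalʳ a b e

does-true⇒ : ∀ {P : Set} (P? : Dec P) → does P? ≡ true → P
does-true⇒ (yes p) _ = p
does-true⇒ (no _) ()

small-complement⇒large-share : ∀ t ζ a b → 1 ≤ t → a + b ≡ t * ζ → b < ζ →
  (t ∸ 1) * (t * ζ) < t * a
small-complement⇒large-share (suc s) ζ a b _ a+b≡ b<ζ =
  subst (_< suc s * a) (sym (x∙yz≈y∙xz s (suc s) ζ)) (*-monoʳ-< (suc s) sζ<a)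
  where
  sζ<a : s * ζ < a
  sζ<a = +-cancelʳ-< b (s * ζ) a (subst (s * ζ + b <_) (trans (+-comm (s * ζ) ζ) (sym a+b≡))
                                         (+-monoʳ-< (s * ζ) b<ζ))

module _ {A : Set} where

  endpoint : A → List A → A
  endpoint a [] = a
  endpoint a (x ∷ xs) = endpoint x xs

  last-∷ : ∀ a xs → last (a ∷ xs) ≡ just (endpoint a xs)
  last-∷ a [] = refl
  last-∷ a (x ∷ xs) = last-∷ x xs

  endpoint-++ : ∀ a xs c ys → endpoint a (xs ++ c ∷ ys) ≡ endpoint c ys
  endpoint-++ a [] c ys = refl
  endpoint-++ a (x ∷ xs) c ys = endpoint-++ x xs c ys

  endpoint-∈ : ∀ a x xs → endpoint a (x ∷ xs) ∈ x ∷ xs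
  endpoint-∈ a x [] = here refl
  endpoint-∈ a x (y ∷ xs) = there (endpoint-∈ x y xs)

  endpoint-split : ∀ a xs ys c zs → a ∷ xs ≡ ys ++ c ∷ zs → endpoint a xs ≡ endpoint c zs
  endpoint-split a xs [] c zs refl = refl
  endpoint-split a .(ys ++ c ∷ zs) (.a ∷ ys) c zs refl = endpoint-++ a ys c zs

  last⇒endpoint : ∀ {a b} xs → last (a ∷ xs) ≡ just b → endpoint a xs ≡ b
  last⇒endpoint {a} xs last≡ = just-injective (trans (sym (last-∷ a xs)) last≡)

  endpoint-ʳ++ : ∀ z xs w acc → endpoint z (xs ʳ++ w ∷ acc) ≡ endpoint w acc
  endpoint-ʳ++ z [] w acc = refl
  endpoint-ʳ++ z (x ∷ xs) w acc = endpoint-ʳ++ z xs x (w ∷ acc)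

  1≤length⇒∈ : ∀ (xs : List A) → 1 ≤ length xs → ∃ (_∈ xs)
  1≤length⇒∈ (x ∷ _) _ = x , here refl

  length-filter-¬? : ∀ {P : A → Set} (P? : Decidable P) xs →
    length (filter P? xs) + length (filter (¬? ∘ P?) xs) ≡ length xs
  length-filter-¬? P? [] = refl
  length-filter-¬? P? (x ∷ xs) with P? x
  ... | yes _ = cong suc (length-filter-¬? P? xs)
  ... | no _ = trans (+-suc _ _) (cong suc (length-filter-¬? P? xs))

  unique-∷ : ∀ {x : A} {xs} → x ∉ xs → Unique xs → Unique (x ∷ xs)
  unique-∷ {xs = xs} x∉xs u = All.¬Any⇒All¬ xs x∉xs ∷ u

  unique-tail : ∀ {x : A} {xs} → Unique (x ∷ xs) → Unique xs
  unique-tail (_ ∷ u) = u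

  unique-++ʳ : ∀ (xs : List A) {ys} → Unique (xs ++ ys) → Unique ys
  unique-++ʳ [] u = u
  unique-++ʳ (x ∷ xs) u = unique-++ʳ xs (unique-tail u)

  unique-++ˡ : ∀ (xs : List A) {ys} → Unique (xs ++ ys) → Unique xs
  unique-++ˡ [] u = []
  unique-++ˡ (x ∷ xs) u =
    unique-∷ (Unique.Unique[x∷xs]⇒x∉xs u ∘ ∈-++⁺ˡ) (unique-++ˡ xs (unique-tail u))

  unique-++-∉ : ∀ (xs : List A) {y ys} → Unique (xs ++ y ∷ ys) → y ∉ xs
  unique-++-∉ (x ∷ xs) u (here refl) = Unique.Unique[x∷xs]⇒x∉xs u (∈-++⁺ʳ xs (here refl))
  unique-++-∉ (x ∷ xs) u (there y∈xs) = unique-++-∉ xs (unique-tail u) y∈xs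

  unique-ʳ++ : ∀ (xs acc : List A) → Unique xs → Unique acc → (∀ {z} → z ∈ xs → z ∉ acc) →
    Unique (xs ʳ++ acc)
  unique-ʳ++ [] acc _ u _ = u
  unique-ʳ++ (x ∷ xs) acc ux uacc disjoint =
    unique-ʳ++ xs (x ∷ acc) (unique-tail ux) (unique-∷ (disjoint (here refl)) uacc) disjoint′
    where
    disjoint′ : ∀ {z} → z ∈ xs → z ∉ x ∷ acc
    disjoint′ z∈xs (here refl) = Unique.Unique[x∷xs]⇒x∉xs ux z∈xs
    disjoint′ z∈xs (there z∈acc) = disjoint (there z∈xs) z∈acc

  all-ʳ++ : ∀ {P : A → Set} (xs acc : List A) → All P xs → All P acc → All P (xs ʳ++ acc)
  all-ʳ++ [] acc _ pacc = pacc
  all-ʳ++ (x ∷ xs) acc (px ∷ pxs) pacc = all-ʳ++ xs (x ∷ acc) pxs (px ∷ pacc)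

module _ {A : Set} (_≟ᴬ_ : DecidableEquality A) where
  open import Data.List.Membership.DecPropositional _≟ᴬ_ using (_∈?_)

  split-at-first : ∀ (ys xs : List A) {z} → z ∈ xs → z ∈ ys →
    ∃₂ λ p₁ c → ∃ λ p₂ → xs ≡ p₁ ++ c ∷ p₂ × All (_∉ ys) p₁ × c ∈ ys
  split-at-first ys (x ∷ xs) z∈xs z∈ys with x ∈? ys
  ... | yes x∈ys = [] , x , xs , refl , [] , x∈ys
  ... | no x∉ys with z∈xs
  ...   | here refl = ⊥-elim (x∉ys z∈ys)
  ...   | there z∈xs′ with split-at-first ys xs z∈xs′ z∈ys
  ...     | p₁ , c , p₂ , refl , p₁∉ys , c∈ys = x ∷ p₁ , c , p₂ , refl , x∉ys ∷ p₁∉ys , c∈ys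

module Paths {n : ℕ} (H : Graph n) where
  open import Data.List.Membership.DecPropositional (_≟_ {n}) using (_∈?_)

  chain-tail : ∀ {x} {xs : List (Fin n)} → Chain H (x ∷ xs) → Chain H xs
  chain-tail {xs = []} _ = tt
  chain-tail {xs = _ ∷ _} (_ , c) = c

  chain-++ʳ : ∀ (xs : List (Fin n)) {ys} → Chain H (xs ++ ys) → Chain H ys
  chain-++ʳ [] c = c
  chain-++ʳ (x ∷ xs) c = chain-++ʳ xs (chain-tail c)

  chain-++ˡ : ∀ (xs : List (Fin n)) {ys} → Chain H (xs ++ ys) → Chain H xs
  chain-++ˡ [] c = tt
  chain-++ˡ (x ∷ []) c = tt
  chain-++ˡ (x ∷ y ∷ xs) (e , c) = e , chain-++ˡ (y ∷ xs) c

  chain-edge : ∀ a (xs : List (Fin n)) c ys → Chain H (a ∷ xs ++ c ∷ ys) → E H (endpoint a xs) c ≡ true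
  chain-edge a [] c ys (e , _) = e
  chain-edge a (x ∷ xs) c ys (_ , ch) = chain-edge x xs c ys ch

  chain-ʳ++ : ∀ x (xs acc : List (Fin n)) → Chain H (x ∷ xs) → Chain H (x ∷ acc) →
    Chain H (xs ʳ++ x ∷ acc)
  chain-ʳ++ x [] acc _ c = c
  chain-ʳ++ x (y ∷ xs) acc (e , c) c′ = chain-ʳ++ y xs (x ∷ acc) c (trans (E-sym H y x) e , c′)

  isPath-tail : ∀ {x} {xs : List (Fin n)} → IsPath H (x ∷ xs) → IsPath H xs
  isPath-tail (u , _ ∷ a , c) = unique-tail u , a , chain-tail c

  isPath-++ʳ : ∀ (xs : List (Fin n)) {ys} → IsPath H (xs ++ ys) → IsPath H ys
  isPath-++ʳ xs (u , a , c) = unique-++ʳ xs u , All.++⁻ʳ xs a , chain-++ʳ xs c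

  isPath-++ˡ : ∀ (xs : List (Fin n)) {ys} → IsPath H (xs ++ ys) → IsPath H xs
  isPath-++ˡ xs (u , a , c) = unique-++ˡ xs u , All.++⁻ˡ xs a , chain-++ˡ xs c

  isPath-ʳ++ : ∀ x (xs acc : List (Fin n)) → IsPath H (x ∷ xs) → IsPath H (x ∷ acc) →
    (∀ {z} → z ∈ x ∷ xs → z ∉ acc) → IsPath H (xs ʳ++ x ∷ acc)
  isPath-ʳ++ x xs acc (ux , ax , cx) (uacc , _ ∷ aacc , cacc) disjoint =
    unique-ʳ++ (x ∷ xs) acc ux (unique-tail uacc) disjoint ,
    all-ʳ++ (x ∷ xs) acc ax aacc ,
    chain-ʳ++ x xs acc cx cacc

  -- Walking along p₁ from a to c and back along q₁ closes a cycle.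
  cycle-of-paths : ∀ a p₁ c p₂ q₁ q₂ →
    IsPath H (a ∷ p₁ ++ c ∷ p₂) → IsPath H (a ∷ q₁ ++ c ∷ q₂) →
    All (_∉ q₁) p₁ → ¬ (p₁ ≡ [] × q₁ ≡ []) → IsCycle H (c ∷ p₁ ʳ++ a ∷ q₁)
  cycle-of-paths a p₁ c p₂ q₁ q₂ P Q p₁∉q₁ nontrivial =
    subst (IsPath H) (++-ʳ++ p₁) cycle-path , long , c , endpoint a q₁ , refl ,
    trans (last-∷ c (p₁ ʳ++ a ∷ q₁)) (cong just (endpoint-ʳ++ c p₁ a q₁)) ,
    chain-edge a q₁ c q₂ (proj₂ (proj₂ Q))
    where
    P′ : IsPath H (a ∷ p₁ ++ [ c ])
    P′ = isPath-++ˡ (a ∷ p₁ ++ [ c ]) (subst (IsPath H ∘ (a ∷_)) (sym (++-assoc p₁ [ c ] p₂)) P)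

    disjoint : ∀ {z} → z ∈ a ∷ p₁ ++ [ c ] → z ∉ q₁
    disjoint (here refl) z∈q₁ = Unique.Unique[x∷xs]⇒x∉xs (proj₁ Q) (∈-++⁺ˡ z∈q₁)
    disjoint (there z∈p₁c) z∈q₁ with ∈-++⁻ p₁ z∈p₁c
    ... | inj₁ z∈p₁ = All.lookup p₁∉q₁ z∈p₁ z∈q₁
    ... | inj₂ (here refl) = unique-++-∉ q₁ (unique-tail (proj₁ Q)) z∈q₁

    cycle-path : IsPath H ((p₁ ++ [ c ]) ʳ++ a ∷ q₁)
    cycle-path = isPath-ʳ++ a (p₁ ++ [ c ]) q₁ P′ (isPath-++ˡ (a ∷ q₁) Q) disjoint

    two≤ : ∀ (xs ys : List (Fin n)) → ¬ (xs ≡ [] × ys ≡ []) → 2 ≤ length xs + suc (length ys)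
    two≤ [] [] nt = ⊥-elim (nt (refl , refl))
    two≤ [] (_ ∷ _) _ = s≤s (s≤s z≤n)
    two≤ (_ ∷ xs) ys _ = s≤s (≤-trans (s≤s z≤n) (m≤n+m (suc (length ys)) (length xs)))

    long : 3 ≤ length (c ∷ p₁ ʳ++ a ∷ q₁)
    long = subst (λ k → 3 ≤ suc k) (sym (length-ʳ++ p₁)) (s≤s (two≤ p₁ q₁ nontrivial))

  acyclic⇒path-unique : Acyclic H → ∀ a (p q : List (Fin n)) →
    IsPath H (a ∷ p) → IsPath H (a ∷ q) → endpoint a p ≡ endpoint a q → p ≡ q
  acyclic⇒path-unique _ a [] [] _ _ _ = refl
  acyclic⇒path-unique _ a [] (y ∷ q) _ Q a≡end =
    ⊥-elim (Unique.Unique[x∷xs]⇒x∉xs (proj₁ Q) (subst (_∈ y ∷ q) (sym a≡end) (endpoint-∈ a y q)))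
  acyclic⇒path-unique _ a (x ∷ p) [] P _ end≡a =
    ⊥-elim (Unique.Unique[x∷xs]⇒x∉xs (proj₁ P) (subst (_∈ x ∷ p) end≡a (endpoint-∈ a x p)))
  acyclic⇒path-unique acyclic a (x ∷ p) (y ∷ q) P Q ends with x ≟ y
  ... | yes refl = cong (x ∷_) (acyclic⇒path-unique acyclic x p q (isPath-tail P) (isPath-tail Q) ends)
  ... | no x≢y
    with p₁ , c , p₂ , xp≡ , p₁∉yq , c∈yq ←
           split-at-first _≟_ (y ∷ q) (x ∷ p) (endpoint-∈ a x p)
             (subst (_∈ y ∷ q) (sym ends) (endpoint-∈ a y q))
    with q₁ , q₂ , yq≡ ← ∈-∃++ c∈yq
    = ⊥-elim (acyclic _ (cycle-of-paths a p₁ c p₂ q₁ q₂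
        (subst (IsPath H ∘ (a ∷_)) xp≡ P) (subst (IsPath H ∘ (a ∷_)) yq≡ Q)
        (All.map (λ z∉yq → z∉yq ∘ subst (_ ∈_) (sym yq≡) ∘ ∈-++⁺ˡ) p₁∉yq)
        nontrivial))
    where
    nontrivial : ¬ (p₁ ≡ [] × q₁ ≡ [])
    nontrivial (refl , refl) = x≢y (trans (∷-injectiveˡ xp≡) (sym (∷-injectiveˡ yq≡)))

  data Walk : Fin n → Fin n → Set where
    stop : ∀ {a} → V H a ≡ true → Walk a a
    step : ∀ {a b c} → E H a b ≡ true → Walk b c → Walk a c

  walk-++ : ∀ {a b c} → Walk a b → Walk b c → Walk a c
  walk-++ (stop _) w = w
  walk-++ (step e w) w′ = step e (walk-++ w w′)

  walk-reverse : ∀ {a b} → Walk a b → Walk b a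
  walk-reverse (stop a∈H) = stop a∈H
  walk-reverse (step {a} {b} e w) =
    walk-++ (walk-reverse w) (step (trans (E-sym H b a) e) (stop (E-V H a b e)))

  path⇒walk : ∀ a xs → IsPath H (a ∷ xs) → Walk a (endpoint a xs)
  path⇒walk a [] (_ , a∈H ∷ _ , _) = stop a∈H
  path⇒walk a (x ∷ xs) P@(_ , _ , (e , _)) = step e (path⇒walk x xs (isPath-tail P))

  -- A walk is shortened to a path by cutting out the segment between repeated visits.
  walk⇒path : ∀ {a b} → Walk a b → Σ (List (Fin n)) λ xs → IsPath H (a ∷ xs) × endpoint a xs ≡ b
  walk⇒path (stop a∈H) = [] , ([] ∷ [] , a∈H ∷ [] , tt) , refl
  walk⇒path (step {a} {b} e w) with walk⇒path w
  ... | xs , P@(u , bxs∈H , c) , end≡ with a ∈? b ∷ xs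
  ...   | no a∉bxs = b ∷ xs , (unique-∷ a∉bxs u , E-V H a b e ∷ bxs∈H , (e , c)) , end≡
  ...   | yes a∈bxs with ys , zs , bxs≡ ← ∈-∃++ a∈bxs =
    zs , isPath-++ʳ ys (subst (IsPath H) bxs≡ P) , trans (sym (endpoint-split b xs ys a zs bxs≡)) end≡

  walk⇒connected : ∀ {a b} → Walk a b → ∃ λ ℓ → ∃ λ p → PathOfLength H a b ℓ p
  walk⇒connected {a} w with xs , P , end≡ ← walk⇒path w =
    length xs , a ∷ xs , P , refl , trans (last-∷ a xs) (cong just end≡) , refl

module RootPaths {n : ℕ} (T : Graph n) (r : Fin n) (rt : RootedTree T r) where
  open Paths T
  open import Data.List.Membership.DecPropositional (_≟_ {n}) using (_∈?_)

  private
    connected : Connected T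
    connected = proj₁ (proj₁ rt)

    r∈T : V T r ≡ true
    r∈T = proj₂ rt

    ancestorsFrom : ∀ x b → V T x ≡ b → List (Fin n)
    ancestorsFrom x true x∈T = drop 1 (proj₁ (proj₂ (connected x r x∈T r∈T)))
    ancestorsFrom x false _ = []

    ancestorsFrom-path : ∀ x b (x∈T : V T x ≡ b) → b ≡ true →
      IsPath T (x ∷ ancestorsFrom x b x∈T) × endpoint x (ancestorsFrom x b x∈T) ≡ r
    ancestorsFrom-path x true x∈T _ with connected x r x∈T r∈T
    ... | _ , [] , (_ , () , _)
    ... | _ , .x ∷ p , (P , refl , last≡ , _) = P , last⇒endpoint p last≡

  -- The path of T from x to r is x ∷ ancestors x (junk value [] when x ∉ V(T)).
  ancestors : Fin n → List (Fin n)
  ancestors x = ancestorsFrom x (V T x) refl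

  root-path : ∀ {x} → V T x ≡ true → IsPath T (x ∷ ancestors x) × endpoint x (ancestors x) ≡ r
  root-path {x} = ancestorsFrom-path x (V T x) refl

  root-pathOfLength : ∀ {x} → V T x ≡ true → PathOfLength T x r (length (ancestors x)) (x ∷ ancestors x)
  root-pathOfLength {x} x∈T =
    proj₁ (root-path x∈T) , refl , trans (last-∷ x (ancestors x)) (cong just (proj₂ (root-path x∈T))) , refl

  ancestors-unique : ∀ {x p} → IsPath T (x ∷ p) → endpoint x p ≡ r → p ≡ ancestors x
  ancestors-unique {x} {p} P end≡r =
    acyclic⇒path-unique (proj₂ (proj₁ rt)) x p (ancestors x) P (proj₁ (root-path x∈T))
      (trans end≡r (sym (proj₂ (root-path x∈T))))
    where
    x∈T : V T x ≡ true
    x∈T = All.head (proj₁ (proj₂ P))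

  ancestors-root : ancestors r ≡ []
  ancestors-root = sym (ancestors-unique ([] ∷ [] , r∈T ∷ [] , tt) refl)

  ancestors-suffix : ∀ {x} ys z zs → V T x ≡ true → x ∷ ancestors x ≡ ys ++ z ∷ zs → zs ≡ ancestors z
  ancestors-suffix {x} ys z zs x∈T eq =
    ancestors-unique (isPath-++ʳ ys (subst (IsPath T) eq (proj₁ (root-path x∈T))))
      (trans (sym (endpoint-split x (ancestors x) ys z zs eq)) (proj₂ (root-path x∈T)))

  ancestors-via : ∀ {v w} → E T v w ≡ true → V T w ≡ true → v ∉ w ∷ ancestors w →
    ancestors v ≡ w ∷ ancestors w
  ancestors-via {v} {w} vw w∈T v∉ with (uw , aw , cw) , end≡r ← root-path w∈T =
    sym (ancestors-unique (unique-∷ v∉ uw , E-V T v w vw ∷ aw , (vw , cw)) end≡r)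

  edge⇒≢ : ∀ {w v} → E T w v ≡ true → w ≢ v
  edge⇒≢ {w} wv refl with trans (sym (E-irr T w)) wv
  ... | ()

  ancestors-child : ∀ {w v} → Child T r w v → ancestors v ≡ w ∷ ancestors w
  ancestors-child (_ , _ , [] , (_ , () , _) , _)
  ancestors-child {v = v} (wv , _ , .v ∷ _ , (_ , refl , _) , here refl) = ⊥-elim (edge⇒≢ wv refl)
  ancestors-child {w} {v} (wv , _ , .v ∷ p , (P , refl , last≡ , _) , there w∈p)
    with ys , zs , refl ← ∈-∃++ w∈p =
    ancestors-via (trans (E-sym T v w) wv) (E-V T w v wv)
      (subst (λ l → v ∉ w ∷ l) zs≡ (Unique.Unique[x∷xs]⇒x∉xs (proj₁ P) ∘ ∈-++⁺ʳ ys))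
    where
    zs≡ : zs ≡ ancestors w
    zs≡ = ancestors-unique (isPath-++ʳ (v ∷ ys) P)
            (trans (sym (endpoint-++ v ys w zs)) (last⇒endpoint (ys ++ w ∷ zs) last≡))

  child⇒≢root : ∀ {w v} → Child T r w v → v ≢ r
  child⇒≢root c refl with trans (sym ancestors-root) (ancestors-child c)
  ... | ()

  edge-ancestor⇒child : ∀ {w v} → E T w v ≡ true → w ∈ ancestors v → Child T r w v
  edge-ancestor⇒child {w} {v} wv w∈ =
    wv , length (ancestors v) , v ∷ ancestors v , root-pathOfLength (E-V T v w (trans (E-sym T v w) wv)) , there w∈

  child? : ∀ w v → Dec (Child T r w v)
  child? w v = Dec.map′ (λ (wv , w∈) → edge-ancestor⇒child wv w∈)
                        (λ c → proj₁ c , subst (w ∈_) (sym (ancestors-child c)) (here refl))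
                        ((E T w v ≟ᵇ true) ×-dec (w ∈? ancestors v))

  hasChild? : ∀ w → Dec (∃ (Child T r w))
  hasChild? w = any? (child? w)

module Pruning {n : ℕ} (T : Graph n) (r : Fin n) (rt : RootedTree T r)
               (chosen : Fin n → List (Fin n))
               (chosen⇒child : ∀ {w v} → v ∈ chosen w → Child T r w v) where
  open Paths T
  open RootPaths T r rt
  open import Data.List.Membership.DecPropositional (_≟_ {n}) using (_∈?_)

  chosenByParent : List (Fin n) → List (Fin n)
  chosenByParent [] = []
  chosenByParent (w ∷ _) = chosen w

  Kept : Fin n → Set
  Kept v = v ≡ r ⊎ v ∈ chosenByParent (ancestors v)

  InS : Fin n → Set
  InS x = V T x ≡ true × All Kept (x ∷ ancestors x)

  InS? : Decidable InS
  InS? x = (V T x ≟ᵇ true)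
    ×-dec All.all? (λ v → (v ≟ r) ⊎-dec (v ∈? chosenByParent (ancestors v))) (x ∷ ancestors x)

  S : Graph n
  S = record
    { V = λ x → does (InS? x)
    ; E = λ x y → E T x y ∧ (does (InS? x) ∧ does (InS? y))
    ; E-sym = λ x y → cong₂ _∧_ (E-sym T x y) (∧-comm (does (InS? x)) (does (InS? y)))
    ; E-irr = λ x → cong (_∧ (does (InS? x) ∧ does (InS? x))) (E-irr T x)
    ; E-V = λ x y e → proj₁ (∧-true⇒ (proj₂ (∧-true⇒ {E T x y} e)))
    }

  vertexS⇒InS : ∀ {x} → V S x ≡ true → InS x
  vertexS⇒InS {x} = does-true⇒ (InS? x)

  InS⇒vertexS : ∀ {x} → InS x → V S x ≡ true
  InS⇒vertexS {x} = Dec.dec-true (InS? x)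

  edgeS⇒ : ∀ {x y} → E S x y ≡ true → E T x y ≡ true × InS x × InS y
  edgeS⇒ {x} {y} e with xy , inS ← ∧-true⇒ {E T x y} e with x∈S , y∈S ← ∧-true⇒ {does (InS? x)} inS =
    xy , vertexS⇒InS x∈S , vertexS⇒InS y∈S

  edgeS⇐ : ∀ {x y} → E T x y ≡ true → InS x → InS y → E S x y ≡ true
  edgeS⇐ xy ix iy = cong₂ _∧_ xy (cong₂ _∧_ (InS⇒vertexS ix) (InS⇒vertexS iy))

  S⊆T : S ⊆G T
  S⊆T = (λ x x∈S → proj₁ (vertexS⇒InS x∈S)) , (λ x y e → proj₁ (edgeS⇒ e))

  InS-root : InS r
  InS-root = proj₂ rt , inj₁ refl ∷ subst (All Kept) (sym ancestors-root) []

  InS-ancestors : ∀ {x} → InS x → All InS (x ∷ ancestors x)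
  InS-ancestors {x} (x∈T , kept) = All.tabulate along
    where
    along : ∀ {z} → z ∈ x ∷ ancestors x → InS z
    along {z} z∈ with ys , zs , eq ← ∈-∃++ z∈ =
      All.lookup (proj₁ (proj₂ (proj₁ (root-path x∈T)))) z∈ ,
      subst (All Kept ∘ (z ∷_)) (ancestors-suffix ys z zs x∈T eq) (All.++⁻ʳ ys (subst (All Kept) eq kept))

  InS-child : ∀ {w v} → Child T r w v → InS v ⇔ (InS w × v ∈ chosen w)
  InS-child {w} {v} c = mk⇔ to from
    where
    up : ancestors v ≡ w ∷ ancestors w
    up = ancestors-child c

    to : InS v → InS w × v ∈ chosen w
    to (_ , inj₁ v≡r ∷ _) = ⊥-elim (child⇒≢root c v≡r)
    to (_ , inj₂ v∈ ∷ kept) =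
      (E-V T w v (proj₁ c) , subst (All Kept) up kept) , subst (λ l → v ∈ chosenByParent l) up v∈

    from : InS w × v ∈ chosen w → InS v
    from ((_ , kept) , v∈) =
      E-V T v w (trans (E-sym T v w) (proj₁ c)) ,
      inj₂ (subst (λ l → v ∈ chosenByParent l) (sym up) v∈) ∷ subst (All Kept) (sym up) kept

  InS⇒root⊎chosen : ∀ {v} → InS v → v ≡ r ⊎ ∃ λ w → v ∈ chosen w
  InS⇒root⊎chosen (_ , inj₁ v≡r ∷ _) = inj₁ v≡r
  InS⇒root⊎chosen {v} (_ , inj₂ v∈ ∷ _) = inj₂ (chosen-parent (ancestors v) v∈)
    where
    chosen-parent : ∀ ws → v ∈ chosenByParent ws → ∃ λ w → v ∈ chosen w
    chosen-parent (w ∷ _) v∈ = w , v∈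

  chainS : ∀ p → Chain T p → All InS p → Chain S p
  chainS [] _ _ = tt
  chainS (x ∷ []) _ _ = tt
  chainS (x ∷ y ∷ p) (xy , c) (ix ∷ iy ∷ ip) = edgeS⇐ xy ix iy , chainS (y ∷ p) c (iy ∷ ip)

  chainT : ∀ p → Chain S p → Chain T p
  chainT [] _ = tt
  chainT (x ∷ []) _ = tt
  chainT (x ∷ y ∷ p) (xy , c) = proj₁ (edgeS⇒ xy) , chainT (y ∷ p) c

  isPathS : ∀ {p} → IsPath T p → All InS p → IsPath S p
  isPathS {p} (u , _ , c) ip = u , All.map InS⇒vertexS ip , chainS p c ip

  isPathT : ∀ {p} → IsPath S p → IsPath T p
  isPathT {p} (u , a , c) = u , All.map (proj₁ ∘ vertexS⇒InS) a , chainT p c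

  root-pathS : ∀ {x ℓ p} → InS x → PathOfLength T x r ℓ p → PathOfLength S x r ℓ p
  root-pathS {p = []} _ (_ , () , _)
  root-pathS {x} {p = .x ∷ p} ix (P , refl , last≡ , len) =
    isPathS P (subst (All InS ∘ (x ∷_)) (sym (ancestors-unique P (last⇒endpoint p last≡))) (InS-ancestors ix)) ,
    refl , last≡ , len

  childS⇔ : ∀ {w v} → Child S r w v ⇔ (InS w × v ∈ chosen w)
  childS⇔ {w} {v} = mk⇔ to from
    where
    to : Child S r w v → InS w × v ∈ chosen w
    to (e , ℓ , p , (P , head≡ , last≡ , len) , w∈p) with wv , _ , iv ← edgeS⇒ e =
      Equivalence.to (InS-child (wv , ℓ , p , (isPathT P , head≡ , last≡ , len) , w∈p)) iv

    from : InS w × v ∈ chosen w → Child S r w v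
    from (iw , v∈) =
      edgeS⇐ (proj₁ c) iw iv , length (ancestors v) , v ∷ ancestors v ,
      root-pathS iv (root-pathOfLength (proj₁ iv)) ,
      subst (λ l → w ∈ v ∷ l) (sym (ancestors-child c)) (there (here refl))
      where
      c : Child T r w v
      c = chosen⇒child v∈
      iv : InS v
      iv = Equivalence.from (InS-child c) (iw , v∈)

  S-rooted : RootedTree S r
  S-rooted = (connectedS , acyclicS) , InS⇒vertexS InS-root
    where
    module PS = Paths S

    walk-to-root : ∀ {x} → InS x → PS.Walk x r
    walk-to-root {x} ix with P , end≡r ← root-path (proj₁ ix) =
      subst (PS.Walk x) end≡r (PS.path⇒walk x (ancestors x) (isPathS P (InS-ancestors ix)))

    connectedS : Connected S
    connectedS a b a∈S b∈S = PS.walk⇒connected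
      (PS.walk-++ (walk-to-root (vertexS⇒InS a∈S)) (PS.walk-reverse (walk-to-root (vertexS⇒InS b∈S))))

    acyclicS : Acyclic S
    acyclicS p (P , long , a , b , head≡ , last≡ , ba) =
      proj₂ (proj₁ rt) p (isPathT P , long , a , b , head≡ , last≡ , proj₁ (edgeS⇒ ba))

module NonNeighbourChoice {n : ℕ} (G T : Graph n) (r : Fin n) (rt : RootedTree T r) (u : Fin n)
                          (t ζ : ℕ) (branching : ∀ w → ∃ (Child T r w) → HasChildren T r w (t * ζ)) where
  open RootPaths T r rt

  children : Fin n → List (Fin n)
  children w with hasChild? w
  ... | yes c = proj₁ (branching w c)
  ... | no _ = []

  children-unique : ∀ w → Unique (children w)
  children-unique w with hasChild? w
  ... | yes c = proj₁ (proj₂ (branching w c))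
  ... | no _ = []

  children-length : ∀ w → ∃ (Child T r w) → length (children w) ≡ t * ζ
  children-length w c with hasChild? w
  ... | yes c′ = proj₁ (proj₂ (proj₂ (branching w c′)))
  ... | no ¬c = ⊥-elim (¬c c)

  children-iff : ∀ w v → (v ∈ children w) ⇔ Child T r w v
  children-iff w v with hasChild? w
  ... | yes c = proj₂ (proj₂ (proj₂ (branching w c))) v
  ... | no ¬c = mk⇔ (λ ()) (λ c → ⊥-elim (¬c (v , c)))

  children-child : ∀ w → All (Child T r w) (children w)
  children-child w = All.tabulate (Equivalence.to (children-iff w _))

  adjacent? : Decidable (λ v → E G u v ≡ true)
  adjacent? v = E G u v ≟ᵇ true

  nonadjacent : Fin n → List (Fin n)
  nonadjacent w = filter (¬? ∘ adjacent?) (children w)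

  chosen : Fin n → List (Fin n)
  chosen w = take ζ (nonadjacent w)

  chosen-unique : ∀ w → Unique (chosen w)
  chosen-unique w = Unique.take⁺ ζ (Unique.filter⁺ (¬? ∘ adjacent?) (children-unique w))

  chosen-length : ∀ w → ζ ≤ length (nonadjacent w) → length (chosen w) ≡ ζ
  chosen-length w enough = trans (length-take ζ (nonadjacent w)) (m≤n⇒m⊓n≡m enough)

  chosen-spec : ∀ w → All (λ v → Child T r w v × ¬ E G u v ≡ true) (chosen w)
  chosen-spec w = All.take⁺ ζ (All.zip (All.filter⁺ (¬? ∘ adjacent?) (children-child w) ,
                                        All.all-filter (¬? ∘ adjacent?) (children w)))

  chosen⇒child : ∀ {w v} → v ∈ chosen w → Child T r w v
  chosen⇒child {w} v∈ = proj₁ (All.lookup (chosen-spec w) v∈)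

  chosen-nonadjacent : ∀ {w v} → v ∈ chosen w → ¬ E G u v ≡ true
  chosen-nonadjacent {w} v∈ = proj₂ (All.lookup (chosen-spec w) v∈)

  ¬bad⇒many-nonadjacent : 1 ≤ t → V T u ≡ false → ¬ Bad G T r (t * ζ) t u →
    ∀ w → ∃ (Child T r w) → ζ ≤ length (nonadjacent w)
  ¬bad⇒many-nonadjacent 1≤t u∉T ¬bad w (v , c) with ζ ≤? length (nonadjacent w)
  ... | yes enough = enough
  ... | no few = ⊥-elim (¬bad (u∉T , w , E-V T w v (proj₁ c) ,
          (children w , children-unique w , children-length w (v , c) , children-iff w) ,
          filter adjacent? (children w) , Unique.filter⁺ adjacent? (children-unique w) ,
          All.zip (All.filter⁺ adjacent? (children-child w) , All.all-filter adjacent? (children w)) ,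
          small-complement⇒large-share t ζ _ _ 1≤t
            (trans (length-filter-¬? adjacent? (children w)) (children-length w (v , c))) (≰⇒> few)))

mainTheorem2 : (t η ζ : ℕ) → 1 ≤ t → 1 ≤ η → 2 ≤ ζ →
    {n : ℕ} (G T : Graph n) (r : Fin n) →
    T ⊆G G → Uniform (t * ζ) η T r →
    (u : Fin n) → V G u ≡ true → V T u ≡ false →
    ¬ Bad G T r (t * ζ) t u →
    Σ (Graph n) λ S → S ⊆G T × Uniform ζ η S r ×
    (∀ v → V S v ≡ true → E G u v ≡ true → v ≡ r)
mainTheorem2 t η ζ 1≤t _ 2≤ζ G T r _ (rt , branching , leaves) u _ u∉T ¬bad =
  S , S⊆T , (S-rooted , branchingS , leavesS) , avoidsS
  where
  open RootPaths T r rt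
  open NonNeighbourChoice G T r rt u t ζ branching
  open Pruning T r rt chosen chosen⇒child

  enough : ∀ w → ∃ (Child T r w) → length (chosen w) ≡ ζ
  enough w c = chosen-length w (¬bad⇒many-nonadjacent 1≤t u∉T ¬bad w c)

  branchingS : ∀ w → ∃ (Child S r w) → HasChildren S r w ζ
  branchingS w (v , c) with iw , v∈ ← Equivalence.to childS⇔ c =
    chosen w , chosen-unique w , enough w (v , chosen⇒child v∈) ,
    λ v → mk⇔ (λ v∈ → Equivalence.from childS⇔ (iw , v∈)) (proj₂ ∘ Equivalence.to childS⇔)

  leavesS : ∀ x → V S x ≡ true → (∀ v → ¬ Child S r x v) → ∃ λ p → PathOfLength S x r η p
  leavesS x x∈S noChild with hasChild? x
  ... | yes c
    with v , v∈ ← 1≤length⇒∈ (chosen x) (subst (1 ≤_) (sym (enough x c)) (≤-trans (s≤s z≤n) 2≤ζ)) =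
    ⊥-elim (noChild v (Equivalence.from childS⇔ (vertexS⇒InS x∈S , v∈)))
  ... | no ¬c with p , P ← leaves x (proj₁ (vertexS⇒InS x∈S)) (λ v c → ¬c (v , c)) =
    p , root-pathS (vertexS⇒InS x∈S) P

  avoidsS : ∀ v → V S v ≡ true → E G u v ≡ true → v ≡ r
  avoidsS v v∈S uv with InS⇒root⊎chosen (vertexS⇒InS v∈S)
  ... | inj₁ v≡r = v≡r
  ... | inj₂ (_ , v∈) = ⊥-elim (chosen-nonadjacent v∈ uv)
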